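{- For every integer $n\ge 1$, $$\mathrm{RB}_n(112)=\mathrm{LS}_n(122)=\sum_{m=0}^{n}\binom{n-1}{n-m}q^{\binom{m}{2}}.$$
   Context: A restricted growth function (RGF) of length $n$ is a sequence $w=w_1\dots w_n$ of positive integers with $w_1=1$ and $w_i\le 1+\max\{w_1,\dots,w_{i-1}\}$ for $i\ge 2$; $R_n$ is the set of RGFs of length $n$. The standardization of a word replaces every occurrence of its smallest letter by $1$, of its next smallest letter by $2$, and so on. An RGF $w$ contains an RGF $v$ if some subword (subsequence, not necessarily consecutive) of $w$ standardizes to $v$; otherwise $w$ avoids $v$. $R_n(v)$ is the set of $w\in R_n$ avoiding $v$. For a word $w$ and position $j$: $\mathrm{ls}(w_j)$ is the number of distinct values $w_i$ with $i<j$ and $w_i<w_j$; $\mathrm{rb}(w_j)$ is the number of distinct values $w_i$ with $i>j$ and $w_i>w_j$; $\mathrm{ls}(w)=\sum_j\mathrm{ls}(w_j)$, $\mathrm{rb}(w)=\sum_j\mathrm{rb}(w_j)$. Then $\mathrm{LS}_n(v)=\sum_{w\in R_n(v)}q^{\mathrm{ls}(w)}$ and $\mathrm{RB}_n(v)=\sum_{w\in R_n(v)}q^{\mathrm{rb}(w)}$. Binomial coefficients $\binom{a}{b}$ are $0$ when $b<0$ or $b>a\ge 0$. -}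

module Defs where

open import Data.Nat using (ℕ; zero; suc; _+_; _∸_; _⊔_; _≤ᵇ_; _<ᵇ_; _≡ᵇ_)
open import Data.Nat.Combinatorics using (_C_)
open import Data.Bool using (Bool; true; false; _∧_; not; if_then_else_)
open import Relation.Binary.PropositionalEquality using (_≡_)
open import Data.List using (List; []; _∷_; map; length; filterᵇ; concatMap; applyUpTo; upTo; _++_)
open import Data.Nat.ListAction using (sum)

-- Words are lists of natural numbers (letters are positive integers).

distinctᵇ : List ℕ → List ℕ
distinctᵇ [] = []
distinctᵇ (x ∷ xs) = x ∷ filterᵇ (λ y → not (x ≡ᵇ y)) (distinctᵇ xs)

nDistinct : List ℕ → ℕ
nDistinct xs = length (distinctᵇ xs)

-- Restricted growth functions.  rgfAux m w : every letter of w is positive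
-- and at most 1 + (running maximum), where m is the maximum of the letters
-- read so far (0 for the empty prefix, so the first letter must be 1).
rgfAux : ℕ → List ℕ → Bool
rgfAux m [] = true
rgfAux m (x ∷ xs) = (1 ≤ᵇ x) ∧ (x ≤ᵇ suc m) ∧ rgfAux (m ⊔ x) xs

isRGF : List ℕ → Bool
isRGF w = rgfAux 0 w

wordsOver : ℕ → ℕ → List (List ℕ)
wordsOver k zero = [] ∷ []
wordsOver k (suc n) = concatMap (λ a → map (a ∷_) (wordsOver k n)) (applyUpTo suc k)

-- R_n : the RGFs of length n (each letter of an RGF of length n is ≤ n).
R : ℕ → List (List ℕ)
R n = filterᵇ isRGF (wordsOver n n)

standardize : List ℕ → List ℕ
standardize u = map (λ x → suc (nDistinct (filterᵇ (λ y → y <ᵇ x) u))) u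

subwords : List ℕ → List (List ℕ)
subwords [] = [] ∷ []
subwords (x ∷ xs) = map (x ∷_) (subwords xs) ++ subwords xs

listEqᵇ : List ℕ → List ℕ → Bool
listEqᵇ [] [] = true
listEqᵇ [] (_ ∷ _) = false
listEqᵇ (_ ∷ _) [] = false
listEqᵇ (x ∷ xs) (y ∷ ys) = (x ≡ᵇ y) ∧ listEqᵇ xs ys

anyᵇ : {A : Set} → (A → Bool) → List A → Bool
anyᵇ p [] = false
anyᵇ p (x ∷ xs) = if p x then true else anyᵇ p xs

contains : List ℕ → List ℕ → Bool
contains w v = anyᵇ (λ u → listEqᵇ (standardize u) v) (subwords w)

Ravoid : ℕ → List ℕ → List (List ℕ)
Ravoid n v = filterᵇ (λ w → not (contains w v)) (R n)

-- ls(w) = Σ_j #{distinct w_i : i < j, w_i < w_j};  prefix accumulated in p.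
lsAux : List ℕ → List ℕ → ℕ
lsAux p [] = 0
lsAux p (x ∷ xs) = nDistinct (filterᵇ (λ y → y <ᵇ x) p) + lsAux (x ∷ p) xs

ls : List ℕ → ℕ
ls w = lsAux [] w

-- rb(w) = Σ_j #{distinct w_i : i > j, w_i > w_j}.
rb : List ℕ → ℕ
rb [] = 0
rb (x ∷ xs) = nDistinct (filterᵇ (λ y → x <ᵇ y) xs) + rb xs

-- Polynomials in q with natural coefficients, represented by their
-- coefficient functions: (P k) is the coefficient of q^k.
Poly : Set
Poly = ℕ → ℕ

_≈ₚ_ : Poly → Poly → Set
P ≈ₚ Q = (k : ℕ) → P k ≡ Q k

-- Σ_{w ∈ S} q^{stat w}
genFun : (List ℕ → ℕ) → List (List ℕ) → Poly
genFun stat S k = length (filterᵇ (λ w → stat w ≡ᵇ k) S)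

LS : ℕ → List ℕ → Poly
LS n v = genFun ls (Ravoid n v)

RB : ℕ → List ℕ → Poly
RB n v = genFun rb (Ravoid n v)

rhs : ℕ → Poly
rhs n k = sum (map (λ m → if (m C 2) ≡ᵇ k then (n ∸ 1) C (n ∸ m) else 0) (upTo (suc n)))

-- An RGF avoids 112 iff it is 1 2 ⋯ m followed by a weakly decreasing word over {1, …, m}; then
-- rb = C(m, 2), and there are C(n−1, n−m) such words of length n. An RGF avoids 122 iff every letter
-- above 1 occurs once, i.e. it is a shuffle of 1s with 2, 3, …, m in increasing order; then
-- ls = C(m, 2), and again there are C(n−1, n−m) of them.
-- Standardization only sees relative order, so containing a pattern of length three means having
-- a triple of positions with the right comparisons; avoidance is then decided by a left-to-right
-- scan, and counting words by their first letter gives recurrences that the hockey-stick and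
-- Pascal identities solve.

module Submission where

open import Algebra.Bundles using (CommutativeMonoid)
import Algebra.Lattice.Properties.BooleanAlgebra as BooleanAlgebra
import Algebra.Properties.CommutativeSemigroup as CommutativeSemigroup
open import Data.Bool using (Bool; true; false; _∧_; _∨_; not; if_then_else_; T)
open import Data.Bool.Properties
  using (⇔→≡; ∧-zeroʳ; ∨-zeroʳ; ∧-identityʳ; ∨-identityʳ; ∧-conicalˡ; ∧-conicalʳ; ∧-distribʳ-∨;
         ∨-∧-booleanAlgebra; ∨-commutativeMonoid; ∨-comm; ∧-assoc; ∧-idem; ∨-idem)
open import Data.Bool.Solver using (module ∨-∧-Solver)
open import Data.List using (List; []; _∷_; map; _++_; length; filterᵇ; concatMap; applyUpTo)
open import Data.List.Properties using (length-map; map-applyUpTo; filter-none)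
open import Data.List.Relation.Unary.All as All using (All; []; _∷_)
open import Data.List.Relation.Unary.All.Properties using (filter⁺; ++⁺)
open import Data.Nat
open import Data.Nat.Combinatorics using (_C_; nCk+nC[k+1]≡[n+1]C[k+1]; nCk≡nC[n∸k]; nC1≡n)
open import Data.Nat.Combinatorics.Specification using (k>n⇒nCk≡0)
open import Data.Nat.ListAction using (sum)
open import Data.Nat.Properties
open import Data.Nat.Solver using (module +-*-Solver)
open import Data.Product using (_×_; _,_)
open import Defs
open import Function using (_∘_; _∋_; id)
open import Function.Bundles using (mk⇔)
open import Relation.Binary.Definitions using (tri<; tri≈; tri>)
open import Relation.Binary.PropositionalEquality
open import Relation.Nullary using (contradiction)
open import Relation.Nullary.Decidable using (T?)

open BooleanAlgebra ∨-∧-booleanAlgebra using (deMorgan₂)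
open CommutativeSemigroup +-commutativeSemigroup using () renaming (interchange to +-interchange)
open CommutativeSemigroup (CommutativeMonoid.commutativeSemigroup ∨-commutativeMonoid)
  using () renaming (interchange to ∨-interchange)

<ᵇ-true : ∀ {m n} → m < n → (m <ᵇ n) ≡ true
<ᵇ-true {zero} {suc n} _ = refl
<ᵇ-true {suc m} {suc n} (s≤s m<n) = <ᵇ-true m<n

<ᵇ-false : ∀ {m n} → n ≤ m → (m <ᵇ n) ≡ false
<ᵇ-false {m} {zero} _ = refl
<ᵇ-false {suc m} {suc n} (s≤s n≤m) = <ᵇ-false n≤m

<ᵇ-irrefl : ∀ n → (n <ᵇ n) ≡ false
<ᵇ-irrefl n = <ᵇ-false {n} ≤-refl

<ᵇ⇒<′ : ∀ {m n} → (m <ᵇ n) ≡ true → m < n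
<ᵇ⇒<′ {m} {n} eq = <ᵇ⇒< m n (subst T (sym eq) _)

<ᵇ≡false⇒≥ : ∀ {m n} → (m <ᵇ n) ≡ false → n ≤ m
<ᵇ≡false⇒≥ eq = ≮⇒≥ (λ m<n → contradiction (trans (sym eq) (<ᵇ-true m<n)) λ ())

<ᵇ-suc : ∀ m n → (m <ᵇ suc n) ≡ (m ≡ᵇ n) ∨ (m <ᵇ n)
<ᵇ-suc zero zero = refl
<ᵇ-suc zero (suc n) = refl
<ᵇ-suc (suc m) zero = refl
<ᵇ-suc (suc m) (suc n) = <ᵇ-suc m n

<ᵇ-suc≤ᵇ : ∀ m n → (m <ᵇ suc n) ≡ (m ≤ᵇ n)
<ᵇ-suc≤ᵇ zero n = refl
<ᵇ-suc≤ᵇ (suc m) n = refl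

≤ᵇ-true : ∀ {m n} → m ≤ n → (m ≤ᵇ n) ≡ true
≤ᵇ-true z≤n = refl
≤ᵇ-true (s≤s m≤n) = <ᵇ-true (s≤s m≤n)

≤ᵇ⇒≤′ : ∀ {m n} → (m ≤ᵇ n) ≡ true → m ≤ n
≤ᵇ⇒≤′ {m} {n} eq = ≤ᵇ⇒≤ m n (subst T (sym eq) _)

≡ᵇ-refl : ∀ n → (n ≡ᵇ n) ≡ true
≡ᵇ-refl zero = refl
≡ᵇ-refl (suc n) = ≡ᵇ-refl n

≡ᵇ-false : ∀ {m n} → m ≢ n → (m ≡ᵇ n) ≡ false
≡ᵇ-false {zero} {zero} m≢n = contradiction refl m≢n
≡ᵇ-false {zero} {suc n} _ = refl
≡ᵇ-false {suc m} {zero} _ = refl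
≡ᵇ-false {suc m} {suc n} m≢n = ≡ᵇ-false (m≢n ∘ cong suc)

≡ᵇ⇒≡′ : ∀ {m n} → (m ≡ᵇ n) ≡ true → m ≡ n
≡ᵇ⇒≡′ {m} {n} eq = ≡ᵇ⇒≡ m n (subst T (sym eq) _)

≡ᵇ-sym : ∀ m n → (m ≡ᵇ n) ≡ (n ≡ᵇ m)
≡ᵇ-sym zero zero = refl
≡ᵇ-sym zero (suc n) = refl
≡ᵇ-sym (suc m) zero = refl
≡ᵇ-sym (suc m) (suc n) = ≡ᵇ-sym m n

ind : Bool → ℕ
ind true = 1
ind false = 0

ind-∧ : ∀ a b → ind (a ∧ b) ≡ (if a then ind b else 0)
ind-∧ true b = refl
ind-∧ false b = refl

ind-if : ∀ b → ind b ≡ (if b then 1 else 0)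
ind-if true = refl
ind-if false = refl

ind-∨-∧ : ∀ a b c → ind ((a ∨ b) ∧ c) ≡ ind (a ∧ c) + ind (b ∧ (not a ∧ c))
ind-∨-∧ true b c rewrite ∧-zeroʳ b = sym (+-identityʳ (ind c))
ind-∨-∧ false b c = refl

if-0 : ∀ (b : Bool) → (if b then 0 else 0) ≡ 0
if-0 true = refl
if-0 false = refl

if-+ : ∀ (b : Bool) x y → (if b then x + y else 0) ≡ (if b then x else 0) + (if b then y else 0)
if-+ true x y = refl
if-+ false x y = refl

Σ< : ℕ → (ℕ → ℕ) → ℕ
Σ< n f = sum (applyUpTo f n)

Σ<-cong : ∀ n {f g} → (∀ i → i < n → f i ≡ g i) → Σ< n f ≡ Σ< n g
Σ<-cong zero eq = refl
Σ<-cong (suc n) eq = cong₂ _+_ (eq 0 z<s) (Σ<-cong n (λ i i<n → eq (suc i) (s<s i<n)))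

Σ<-zero : ∀ n {f} → (∀ i → i < n → f i ≡ 0) → Σ< n f ≡ 0
Σ<-zero zero eq = refl
Σ<-zero (suc n) eq rewrite eq 0 z<s = Σ<-zero n (λ i i<n → eq (suc i) (s<s i<n))

Σ<-+ : ∀ n f g → Σ< n (λ i → f i + g i) ≡ Σ< n f + Σ< n g
Σ<-+ zero f g = refl
Σ<-+ (suc n) f g rewrite Σ<-+ n (f ∘ suc) (g ∘ suc) = +-interchange (f 0) (g 0) _ _

Σ<-last : ∀ n f → Σ< (suc n) f ≡ Σ< n f + f n
Σ<-last zero f = +-comm (f 0) 0
Σ<-last (suc n) f rewrite Σ<-last n (f ∘ suc) = sym (+-assoc (f 0) _ _)

Σ<-mono : ∀ n {f g} → (∀ i → i < n → f i ≤ g i) → Σ< n f ≤ Σ< n g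
Σ<-mono zero le = ≤-refl
Σ<-mono (suc n) le = +-mono-≤ (le 0 z<s) (Σ<-mono n (λ i i<n → le (suc i) (s<s i<n)))

Σ<-strict : ∀ n {f g} j → j < n → f j < g j → (∀ i → i < n → f i ≤ g i) → Σ< n f < Σ< n g
Σ<-strict (suc n) zero _ lt le = +-mono-<-≤ lt (Σ<-mono n (λ i i<n → le (suc i) (s<s i<n)))
Σ<-strict (suc n) (suc j) (s<s j<n) lt le =
  +-mono-≤-< (le 0 z<s) (Σ<-strict n j j<n lt (λ i i<n → le (suc i) (s<s i<n)))

Σ<-point : ∀ n m (f : ℕ → ℕ) → m < n → Σ< n (λ i → if i ≡ᵇ m then f i else 0) ≡ f m
Σ<-point (suc n) zero f _ = trans (cong (f 0 +_) (Σ<-zero n (λ _ _ → refl))) (+-identityʳ (f 0))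
Σ<-point (suc n) (suc m) f (s<s m<n) = Σ<-point n m (f ∘ suc) m<n

Σ<-if : ∀ n (b : Bool) f → Σ< n (λ i → if b then f i else 0) ≡ (if b then Σ< n f else 0)
Σ<-if n true f = refl
Σ<-if n false f = Σ<-zero n (λ _ _ → refl)

Σ<-prefix : ∀ n m f → m ≤ n → Σ< n (λ i → if i <ᵇ m then f i else 0) ≡ Σ< m f
Σ<-prefix n zero f _ = Σ<-zero n (λ _ _ → refl)
Σ<-prefix (suc n) (suc m) f (s≤s m≤n) = cong (f 0 +_) (Σ<-prefix n m (f ∘ suc) m≤n)

Σ<-interval : ∀ n lo hi → hi ≤ n → Σ< n (λ k → ind ((lo ≤ᵇ k) ∧ (k <ᵇ hi))) ≡ hi ∸ lo
Σ<-interval n lo zero _ = trans (Σ<-zero n (λ k _ → cong ind (∧-zeroʳ (lo ≤ᵇ k)))) (sym (0∸n≡0 lo))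
Σ<-interval (suc n) zero (suc hi) (s≤s hi≤n) = cong suc (Σ<-interval n zero hi hi≤n)
Σ<-interval (suc n) (suc lo) (suc hi) (s≤s hi≤n) =
  trans (Σ<-cong n (λ k _ → cong (λ b → ind (b ∧ (k <ᵇ hi))) (<ᵇ-suc≤ᵇ lo k))) (Σ<-interval n lo hi hi≤n)

count : {A : Set} → (A → Bool) → List A → ℕ
count p xs = length (filterᵇ p xs)

module _ {A : Set} where

  count-∷ : ∀ (p : A → Bool) x xs → count p (x ∷ xs) ≡ ind (p x) + count p xs
  count-∷ p x xs with p x
  ... | true = refl
  ... | false = refl

  count-filterᵇ : ∀ (p q : A → Bool) xs → count q (filterᵇ p xs) ≡ count (λ x → p x ∧ q x) xs
  count-filterᵇ p q [] = refl
  count-filterᵇ p q (x ∷ xs) with p x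
  ... | false = count-filterᵇ p q xs
  ... | true with q x
  ...   | true = cong suc (count-filterᵇ p q xs)
  ...   | false = count-filterᵇ p q xs

  count-true : ∀ (xs : List A) → count (λ _ → true) xs ≡ length xs
  count-true [] = refl
  count-true (x ∷ xs) = cong suc (count-true xs)

  count-++ : ∀ (p : A → Bool) xs ys → count p (xs ++ ys) ≡ count p xs + count p ys
  count-++ p [] ys = refl
  count-++ p (x ∷ xs) ys rewrite count-∷ p x (xs ++ ys) | count-∷ p x xs | count-++ p xs ys =
    sym (+-assoc (ind (p x)) _ _)

  count-map : ∀ {B : Set} (p : B → Bool) (f : A → B) xs → count p (map f xs) ≡ count (p ∘ f) xs
  count-map p f [] = refl
  count-map p f (x ∷ xs) with p (f x)
  ... | true = cong suc (count-map p f xs)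
  ... | false = count-map p f xs

  count-cong : ∀ {p q : A → Bool} → (∀ x → p x ≡ q x) → ∀ xs → count p xs ≡ count q xs
  count-cong eq [] = refl
  count-cong {p} {q} eq (x ∷ xs) rewrite count-∷ p x xs | count-∷ q x xs | eq x =
    cong (ind (q x) +_) (count-cong eq xs)

  count-none : ∀ {p : A → Bool} → (∀ x → p x ≡ false) → ∀ xs → count p xs ≡ 0
  count-none none xs = trans (count-cong none xs) (count-false xs)
    where
    count-false : ∀ xs → count {A} (λ _ → false) xs ≡ 0
    count-false [] = refl
    count-false (_ ∷ xs) = count-false xs

  count-concatMap-applyUpTo : ∀ (p : A → Bool) (f : ℕ → List A) g n →
                              count p (concatMap f (applyUpTo g n)) ≡ Σ< n (count p ∘ f ∘ g)
  count-concatMap-applyUpTo p f g zero = refl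
  count-concatMap-applyUpTo p f g (suc n) =
    trans (count-++ p (f (g 0)) _) (cong (count p (f (g 0)) +_) (count-concatMap-applyUpTo p f (g ∘ suc) n))

countWords : ℕ → ℕ → (List ℕ → Bool) → ℕ
countWords K L P = count P (wordsOver K L)

countWords-zero : ∀ K P → countWords K 0 P ≡ ind (P [])
countWords-zero K P = trans (count-∷ P [] []) (+-identityʳ _)

countWords-suc : ∀ K L P → countWords K (suc L) P ≡ Σ< K (λ i → countWords K L (P ∘ (suc i ∷_)))
countWords-suc K L P = trans (count-concatMap-applyUpTo P (λ a → map (a ∷_) (wordsOver K L)) suc K)
                             (Σ<-cong K (λ i _ → count-map P (suc i ∷_) (wordsOver K L)))

countWords-cong : ∀ K L {P Q} → (∀ w → P w ≡ Q w) → countWords K L P ≡ countWords K L Q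
countWords-cong K L eq = count-cong eq (wordsOver K L)

countWords-none : ∀ K L {P} → (∀ w → P w ≡ false) → countWords K L P ≡ 0
countWords-none K L none = count-none none (wordsOver K L)

genFun-Ravoid : ∀ stat n v k →
  genFun stat (Ravoid n v) k ≡ countWords n n (λ w → isRGF w ∧ (not (contains w v) ∧ (stat w ≡ᵇ k)))
genFun-Ravoid stat n v k = trans (count-filterᵇ _ _ (R n)) (count-filterᵇ isRGF _ (wordsOver n n))

module _ {A : Set} where

  anyᵇ-∷ : ∀ (p : A → Bool) x xs → anyᵇ p (x ∷ xs) ≡ p x ∨ anyᵇ p xs
  anyᵇ-∷ p x xs with p x
  ... | true = refl
  ... | false = refl

  anyᵇ-++ : ∀ (p : A → Bool) xs ys → anyᵇ p (xs ++ ys) ≡ anyᵇ p xs ∨ anyᵇ p ys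
  anyᵇ-++ p [] ys = refl
  anyᵇ-++ p (x ∷ xs) ys with p x
  ... | true = refl
  ... | false = anyᵇ-++ p xs ys

  anyᵇ-map : ∀ {B : Set} (p : B → Bool) (f : A → B) xs → anyᵇ p (map f xs) ≡ anyᵇ (p ∘ f) xs
  anyᵇ-map p f [] = refl
  anyᵇ-map p f (x ∷ xs) with p (f x)
  ... | true = refl
  ... | false = anyᵇ-map p f xs

  anyᵇ-cong : ∀ {p q : A → Bool} → (∀ x → p x ≡ q x) → ∀ xs → anyᵇ p xs ≡ anyᵇ q xs
  anyᵇ-cong eq [] = refl
  anyᵇ-cong {p} {q} eq (x ∷ xs) rewrite anyᵇ-∷ p x xs | anyᵇ-∷ q x xs | eq x = cong (q x ∨_) (anyᵇ-cong eq xs)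

  anyᵇ-false : ∀ xs → anyᵇ {A} (λ _ → false) xs ≡ false
  anyᵇ-false [] = refl
  anyᵇ-false (x ∷ xs) = anyᵇ-false xs

  anyᵇ-∧ : ∀ b (p : A → Bool) xs → anyᵇ (λ x → b ∧ p x) xs ≡ b ∧ anyᵇ p xs
  anyᵇ-∧ false p xs = anyᵇ-false xs
  anyᵇ-∧ true p xs = refl

  anyᵇ-∨ : ∀ (p q : A → Bool) xs → anyᵇ (λ x → p x ∨ q x) xs ≡ anyᵇ p xs ∨ anyᵇ q xs
  anyᵇ-∨ p q [] = refl
  anyᵇ-∨ p q (x ∷ xs) rewrite anyᵇ-∷ (λ x → p x ∨ q x) x xs | anyᵇ-∷ p x xs | anyᵇ-∷ q x xs
                            | anyᵇ-∨ p q xs = ∨-interchange (p x) (q x) _ _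

elem : ℕ → List ℕ → Bool
elem k xs = anyᵇ (k ≡ᵇ_) xs

elem-∷ : ∀ k x xs → elem k (x ∷ xs) ≡ (k ≡ᵇ x) ∨ elem k xs
elem-∷ k x xs with k ≡ᵇ x
... | true = refl
... | false = refl

elem-here : ∀ x xs → elem x (x ∷ xs) ≡ true
elem-here x xs rewrite ≡ᵇ-refl x = refl

elem-there : ∀ k x xs → elem k xs ≡ true → elem k (x ∷ xs) ≡ true
elem-there k x xs k∈xs rewrite elem-∷ k x xs | k∈xs = ∨-zeroʳ (k ≡ᵇ x)

elem-++ : ∀ k xs ys → elem k (xs ++ ys) ≡ elem k xs ∨ elem k ys
elem-++ k xs ys = anyᵇ-++ (k ≡ᵇ_) xs ys

elem-filterᵇ : ∀ k (p : ℕ → Bool) xs → elem k (filterᵇ p xs) ≡ elem k xs ∧ p k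
elem-filterᵇ k p [] = refl
elem-filterᵇ k p (x ∷ xs) with p x in px
... | true rewrite elem-∷ k x (filterᵇ p xs) | elem-∷ k x xs | elem-filterᵇ k p xs with k ≡ᵇ x in k≡ᵇx
...   | true rewrite ≡ᵇ⇒≡′ {k} {x} k≡ᵇx | px = refl
...   | false = refl
elem-filterᵇ k p (x ∷ xs) | false rewrite elem-∷ k x xs | elem-filterᵇ k p xs with k ≡ᵇ x in k≡ᵇx
...   | true rewrite ≡ᵇ⇒≡′ {k} {x} k≡ᵇx | px = ∧-zeroʳ (elem x xs)
...   | false = refl

All-elem : ∀ {P : ℕ → Set} {k} xs → All P xs → elem k xs ≡ true → P k
All-elem {k = k} (x ∷ xs) (px ∷ pxs) k∈ with k ≡ᵇ x in k≡ᵇx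
... | true rewrite ≡ᵇ⇒≡′ {k} {x} k≡ᵇx = px
... | false = All-elem xs pxs k∈

elem-self : ∀ p → All (λ x → elem x p ≡ true) p
elem-self [] = []
elem-self (x ∷ p) = elem-here x p ∷ All.map (λ {y} → elem-there y x p) (elem-self p)

maximum : List ℕ → ℕ
maximum [] = 0
maximum (x ∷ xs) = x ⊔ maximum xs

≤-maximum : ∀ xs → All (_≤ maximum xs) xs
≤-maximum [] = []
≤-maximum (x ∷ xs) =
  m≤m⊔n x (maximum xs) ∷ All.map (λ y≤ → ≤-trans y≤ (m≤n⊔m x (maximum xs))) (≤-maximum xs)

maximum-least : ∀ {M} xs → All (_≤ M) xs → maximum xs ≤ M
maximum-least [] [] = z≤n
maximum-least (x ∷ xs) (x≤M ∷ xs≤M) = ⊔-lub x≤M (maximum-least xs xs≤M)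

⊔-⊔-maximum : ∀ M a {M′} s → M ⊔ a ≡ M′ → M ⊔ (a ⊔ maximum s) ≡ M′ ⊔ maximum s
⊔-⊔-maximum M a s eq = trans (sym (⊔-assoc M a (maximum s))) (cong (_⊔ maximum s) eq)

count-distinctᵇ : ∀ {B} xs → All (_< B) xs → ∀ P →
                  count P (distinctᵇ xs) ≡ Σ< B (λ k → ind (elem k xs ∧ P k))
count-distinctᵇ {B} [] _ P = sym (Σ<-zero B (λ _ _ → refl))
count-distinctᵇ {B} (x ∷ xs) (x<B ∷ xs<B) P = begin
    count P (x ∷ filterᵇ (λ y → not (x ≡ᵇ y)) (distinctᵇ xs))
  ≡⟨ count-∷ P x _ ⟩
    ind (P x) + count P (filterᵇ (λ y → not (x ≡ᵇ y)) (distinctᵇ xs))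
  ≡⟨ cong (ind (P x) +_) (trans (count-filterᵇ _ P (distinctᵇ xs)) (count-distinctᵇ xs xs<B _)) ⟩
    ind (P x) + Σ< B (λ k → ind (elem k xs ∧ (not (x ≡ᵇ k) ∧ P k)))
  ≡⟨ cong₂ _+_ (sym (Σ<-point B x (ind ∘ P) x<B))
               (Σ<-cong B (λ k _ → cong (λ b → ind (elem k xs ∧ (not b ∧ P k))) (≡ᵇ-sym x k))) ⟩
    Σ< B (λ k → if k ≡ᵇ x then ind (P k) else 0) + Σ< B (λ k → ind (elem k xs ∧ (not (k ≡ᵇ x) ∧ P k)))
  ≡⟨ sym (Σ<-+ B _ _) ⟩
    Σ< B (λ k → (if k ≡ᵇ x then ind (P k) else 0) + ind (elem k xs ∧ (not (k ≡ᵇ x) ∧ P k)))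
  ≡⟨ Σ<-cong B (λ k _ → split k) ⟩
    Σ< B (λ k → ind (elem k (x ∷ xs) ∧ P k))
  ∎
  where
  open ≡-Reasoning
  split : ∀ k → (if k ≡ᵇ x then ind (P k) else 0) + ind (elem k xs ∧ (not (k ≡ᵇ x) ∧ P k))
              ≡ ind (elem k (x ∷ xs) ∧ P k)
  split k rewrite elem-∷ k x xs | ind-∨-∧ (k ≡ᵇ x) (elem k xs) (P k) =
    cong (_+ ind (elem k xs ∧ (not (k ≡ᵇ x) ∧ P k))) (sym (ind-∧ (k ≡ᵇ x) (P k)))

nDistinct-Σ : ∀ {B} xs → All (_< B) xs → nDistinct xs ≡ Σ< B (λ k → ind (elem k xs))
nDistinct-Σ {B} xs xs<B = begin
    length (distinctᵇ xs)             ≡⟨ sym (count-true (distinctᵇ xs)) ⟩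
    count (λ _ → true) (distinctᵇ xs) ≡⟨ count-distinctᵇ xs xs<B _ ⟩
    Σ< B (λ k → ind (elem k xs ∧ true)) ≡⟨ Σ<-cong B (λ k _ → cong ind (∧-identityʳ (elem k xs))) ⟩
    Σ< B (λ k → ind (elem k xs))      ∎
  where open ≡-Reasoning

run : ℕ → ℕ → List ℕ
run i zero = []
run i (suc l) = i ∷ run (suc i) l

run-bounded : ∀ i l → All (_< i + l) (run i l)
run-bounded i zero = []
run-bounded i (suc l) rewrite +-suc i l = s≤s (m≤m+n i l) ∷ run-bounded (suc i) l

run-++-∷ : ∀ i l s → run i l ++ (i + l ∷ s) ≡ run i (suc l) ++ s
run-++-∷ i zero s rewrite +-identityʳ i = refl
run-++-∷ i (suc l) s rewrite +-suc i l = cong (i ∷_) (run-++-∷ (suc i) l s)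

elem-run : ∀ k i l → elem k (run i l) ≡ (i ≤ᵇ k) ∧ (k <ᵇ i + l)
elem-run k i zero rewrite +-identityʳ i = sym (empty i k)
  where
  empty : ∀ i k → (i ≤ᵇ k) ∧ (k <ᵇ i) ≡ false
  empty zero k = refl
  empty (suc i) zero = refl
  empty (suc i) (suc k) rewrite <ᵇ-suc≤ᵇ i k = empty i k
elem-run k i (suc l) rewrite elem-∷ k i (run (suc i) l) | elem-run k (suc i) l | +-suc i l = extend i k l
  where
  extend : ∀ i k l → (k ≡ᵇ i) ∨ ((i <ᵇ k) ∧ (k <ᵇ suc (i + l))) ≡ (i ≤ᵇ k) ∧ (k <ᵇ suc (i + l))
  extend zero zero l = refl
  extend zero (suc k) l = refl
  extend (suc i) zero l = refl
  extend (suc i) (suc k) l rewrite <ᵇ-suc≤ᵇ i k = extend i k l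

-- Rank and standardization

-- standardize u is, by definition, map (suc ∘ rank u) u.
rank : List ℕ → ℕ → ℕ
rank u x = nDistinct (filterᵇ (_<ᵇ x) u)

rank-Σ : ∀ {B} u x → All (_< B) u → rank u x ≡ Σ< B (λ k → ind (elem k u ∧ (k <ᵇ x)))
rank-Σ {B} u x u<B = trans (nDistinct-Σ _ (filter⁺ (T? ∘ (_<ᵇ x)) u<B))
                           (Σ<-cong B (λ k _ → cong ind (elem-filterᵇ k (_<ᵇ x) u)))

rank-Σmax : ∀ u x → rank u x ≡ Σ< (suc (maximum u)) (λ k → ind (elem k u ∧ (k <ᵇ x)))
rank-Σmax u x = rank-Σ u x (All.map s≤s (≤-maximum u))

ind-<ᵇ-mono : ∀ b k {x y} → x ≤ y → ind (b ∧ (k <ᵇ x)) ≤ ind (b ∧ (k <ᵇ y))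
ind-<ᵇ-mono false k x≤y = ≤-refl
ind-<ᵇ-mono true k {x} x≤y with k <ᵇ x in k<x
... | false = z≤n
... | true rewrite <ᵇ-true (<-≤-trans (<ᵇ⇒<′ k<x) x≤y) = ≤-refl

rank-mono : ∀ u {x y} → x ≤ y → rank u x ≤ rank u y
rank-mono u {x} {y} x≤y rewrite rank-Σmax u x | rank-Σmax u y =
  Σ<-mono (suc (maximum u)) (λ k _ → ind-<ᵇ-mono (elem k u) k x≤y)

rank-strict : ∀ u {x y} → elem x u ≡ true → x < y → rank u x < rank u y
rank-strict u {x} {y} x∈u x<y rewrite rank-Σmax u x | rank-Σmax u y =
  Σ<-strict (suc (maximum u)) x (s≤s (All-elem u (≤-maximum u) x∈u)) gap
            (λ k _ → ind-<ᵇ-mono (elem k u) k (<⇒≤ x<y))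
  where
  gap : ind (elem x u ∧ (x <ᵇ x)) < ind (elem x u ∧ (x <ᵇ y))
  gap rewrite x∈u | <ᵇ-irrefl x | <ᵇ-true x<y = z<s

rank-injective : ∀ u {x y} → elem x u ≡ true → elem y u ≡ true → rank u x ≡ rank u y → x ≡ y
rank-injective u {x} {y} x∈u y∈u eq with <-cmp x y
... | tri< x<y _ _ = contradiction eq (<⇒≢ (rank-strict u x∈u x<y))
... | tri≈ _ x≡y _ = x≡y
... | tri> _ _ y<x = contradiction (sym eq) (<⇒≢ (rank-strict u y∈u y<x))

rank-cancel-< : ∀ u {x y} → rank u x < rank u y → x < y
rank-cancel-< u {x} {y} lt = ≰⇒> (λ y≤x → <⇒≱ lt (rank-mono u y≤x))

listEqᵇ⇒≡ : ∀ xs ys → listEqᵇ xs ys ≡ true → xs ≡ ys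
listEqᵇ⇒≡ [] [] _ = refl
listEqᵇ⇒≡ (x ∷ xs) (y ∷ ys) eq =
  cong₂ _∷_ (≡ᵇ⇒≡′ (∧-conicalˡ _ _ eq)) (listEqᵇ⇒≡ xs ys (∧-conicalʳ (x ≡ᵇ y) _ eq))

listEqᵇ-length : ∀ xs ys → length xs ≢ length ys → listEqᵇ xs ys ≡ false
listEqᵇ-length [] [] ne = contradiction refl ne
listEqᵇ-length [] (_ ∷ _) ne = refl
listEqᵇ-length (_ ∷ _) [] ne = refl
listEqᵇ-length (x ∷ xs) (y ∷ ys) ne rewrite listEqᵇ-length xs ys (ne ∘ cong suc) = ∧-zeroʳ (x ≡ᵇ y)

pattern112 pattern122 : ℕ → ℕ → ℕ → Bool
pattern112 a b c = (a ≡ᵇ b) ∧ (a <ᵇ c)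
pattern122 a b c = (a <ᵇ b) ∧ (b ≡ᵇ c)

standardize-aac : ∀ {a c} → a < c → standardize (a ∷ a ∷ c ∷ []) ≡ 1 ∷ 1 ∷ 2 ∷ []
-- Each rewrite exposes the next comparison made by filterᵇ, hence the repetitions.
standardize-aac {a} {c} a<c
  rewrite <ᵇ-irrefl a | <ᵇ-irrefl a | <ᵇ-false (<⇒≤ a<c)
        | <ᵇ-true a<c | <ᵇ-true a<c | <ᵇ-irrefl c | ≡ᵇ-refl a = refl

standardize-abb : ∀ {a b} → a < b → standardize (a ∷ b ∷ b ∷ []) ≡ 1 ∷ 2 ∷ 2 ∷ []
standardize-abb {a} {b} a<b
  rewrite <ᵇ-irrefl a | <ᵇ-false (<⇒≤ a<b) | <ᵇ-false (<⇒≤ a<b)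
        | <ᵇ-true a<b | <ᵇ-irrefl b | <ᵇ-irrefl b = refl

suc-∷³-injective : ∀ {x y z p q r} → (List ℕ ∋ suc x ∷ suc y ∷ suc z ∷ []) ≡ suc p ∷ suc q ∷ suc r ∷ [] →
                   x ≡ p × y ≡ q × z ≡ r
suc-∷³-injective refl = refl , refl , refl

elem-∷³ : ∀ a b c → let u = a ∷ b ∷ c ∷ [] in elem a u ≡ true × elem b u ≡ true × elem c u ≡ true
elem-∷³ a b c = elem-here a (b ∷ c ∷ []) , elem-there b a (b ∷ c ∷ []) (elem-here b (c ∷ [])) ,
                elem-there c a (b ∷ c ∷ []) (elem-there c b (c ∷ []) (elem-here c []))

standardize≡112 : ∀ a b c → standardize (a ∷ b ∷ c ∷ []) ≡ 1 ∷ 1 ∷ 2 ∷ [] → a ≡ b × a < c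
standardize≡112 a b c eq with suc-∷³-injective eq | elem-∷³ a b c
... | ra , rb , rc | a∈ , b∈ , _ =
  rank-injective u a∈ b∈ (trans ra (sym rb)) , rank-cancel-< u (subst₂ _<_ (sym ra) (sym rc) z<s)
  where u = a ∷ b ∷ c ∷ []

standardize≡122 : ∀ a b c → standardize (a ∷ b ∷ c ∷ []) ≡ 1 ∷ 2 ∷ 2 ∷ [] → a < b × b ≡ c
standardize≡122 a b c eq with suc-∷³-injective eq | elem-∷³ a b c
... | ra , rb , rc | _ , b∈ , c∈ =
  rank-cancel-< u (subst₂ _<_ (sym ra) (sym rb) z<s) , rank-injective u b∈ c∈ (trans rb (sym rc))
  where u = a ∷ b ∷ c ∷ []

matches-112 : ∀ a b c → listEqᵇ (standardize (a ∷ b ∷ c ∷ [])) (1 ∷ 1 ∷ 2 ∷ []) ≡ pattern112 a b c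
matches-112 a b c = ⇔→≡ (mk⇔ to from)
  where
  to : listEqᵇ (standardize (a ∷ b ∷ c ∷ [])) (1 ∷ 1 ∷ 2 ∷ []) ≡ true → pattern112 a b c ≡ true
  to eq with standardize≡112 a b c (listEqᵇ⇒≡ _ _ eq)
  ... | refl , a<c rewrite ≡ᵇ-refl a = <ᵇ-true a<c
  from : pattern112 a b c ≡ true → listEqᵇ (standardize (a ∷ b ∷ c ∷ [])) (1 ∷ 1 ∷ 2 ∷ []) ≡ true
  from eq with ≡ᵇ⇒≡′ {a} {b} (∧-conicalˡ _ _ eq)
  ... | refl = cong (λ s → listEqᵇ s (1 ∷ 1 ∷ 2 ∷ []))
                    (standardize-aac (<ᵇ⇒<′ {a} {c} (∧-conicalʳ (a ≡ᵇ a) _ eq)))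

matches-122 : ∀ a b c → listEqᵇ (standardize (a ∷ b ∷ c ∷ [])) (1 ∷ 2 ∷ 2 ∷ []) ≡ pattern122 a b c
matches-122 a b c = ⇔→≡ (mk⇔ to from)
  where
  to : listEqᵇ (standardize (a ∷ b ∷ c ∷ [])) (1 ∷ 2 ∷ 2 ∷ []) ≡ true → pattern122 a b c ≡ true
  to eq with standardize≡122 a b c (listEqᵇ⇒≡ _ _ eq)
  ... | a<b , refl rewrite ≡ᵇ-refl b = trans (∧-identityʳ _) (<ᵇ-true a<b)
  from : pattern122 a b c ≡ true → listEqᵇ (standardize (a ∷ b ∷ c ∷ [])) (1 ∷ 2 ∷ 2 ∷ []) ≡ true
  from eq with ≡ᵇ⇒≡′ {b} {c} (∧-conicalʳ (a <ᵇ b) _ eq)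
  ... | refl = cong (λ s → listEqᵇ s (1 ∷ 2 ∷ 2 ∷ []))
                    (standardize-abb (<ᵇ⇒<′ {a} {b} (∧-conicalˡ _ _ eq)))

-- Occurrences of patterns of length three

anyᵇ-subwords-∷ : ∀ (p : List ℕ → Bool) x xs →
  anyᵇ p (subwords (x ∷ xs)) ≡ anyᵇ (p ∘ (x ∷_)) (subwords xs) ∨ anyᵇ p (subwords xs)
anyᵇ-subwords-∷ p x xs = trans (anyᵇ-++ p (map (x ∷_) (subwords xs)) (subwords xs))
                               (cong (_∨ anyᵇ p (subwords xs)) (anyᵇ-map p (x ∷_) (subwords xs)))

onNil : Bool → List ℕ → Bool
onNil b [] = b
onNil b (_ ∷ _) = false

onSingletons : (ℕ → Bool) → List ℕ → Bool
onSingletons h (x ∷ []) = h x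
onSingletons h _ = false

onPairs : (ℕ → ℕ → Bool) → List ℕ → Bool
onPairs g (x ∷ y ∷ []) = g x y
onPairs g _ = false

onTriples : (ℕ → ℕ → ℕ → Bool) → List ℕ → Bool
onTriples t (x ∷ y ∷ z ∷ []) = t x y z
onTriples t _ = false

anyPair : (ℕ → ℕ → Bool) → List ℕ → Bool
anyPair g [] = false
anyPair g (y ∷ ys) = anyᵇ (g y) ys ∨ anyPair g ys

anyTriple : (ℕ → ℕ → ℕ → Bool) → List ℕ → Bool
anyTriple t [] = false
anyTriple t (x ∷ xs) = anyPair (t x) xs ∨ anyTriple t xs

anyᵇ-subwords-onNil : ∀ b zs → anyᵇ (onNil b) (subwords zs) ≡ b
anyᵇ-subwords-onNil false [] = refl
anyᵇ-subwords-onNil true [] = refl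
anyᵇ-subwords-onNil b (z ∷ zs) rewrite anyᵇ-subwords-∷ (onNil b) z zs | anyᵇ-false (subwords zs) =
  anyᵇ-subwords-onNil b zs

anyᵇ-subwords-onSingletons : ∀ h zs → anyᵇ (onSingletons h) (subwords zs) ≡ anyᵇ h zs
anyᵇ-subwords-onSingletons h [] = refl
anyᵇ-subwords-onSingletons h (z ∷ zs) rewrite anyᵇ-subwords-∷ (onSingletons h) z zs | anyᵇ-∷ h z zs =
  cong₂ _∨_ (trans (anyᵇ-cong (λ { [] → refl ; (_ ∷ _) → refl }) (subwords zs)) (anyᵇ-subwords-onNil (h z) zs))
            (anyᵇ-subwords-onSingletons h zs)

anyᵇ-subwords-onPairs : ∀ g ys → anyᵇ (onPairs g) (subwords ys) ≡ anyPair g ys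
anyᵇ-subwords-onPairs g [] = refl
anyᵇ-subwords-onPairs g (y ∷ ys) rewrite anyᵇ-subwords-∷ (onPairs g) y ys =
  cong₂ _∨_ (trans (anyᵇ-cong (λ { [] → refl ; (_ ∷ []) → refl ; (_ ∷ _ ∷ _) → refl }) (subwords ys))
                   (anyᵇ-subwords-onSingletons (g y) ys))
            (anyᵇ-subwords-onPairs g ys)

anyᵇ-subwords-onTriples : ∀ t xs → anyᵇ (onTriples t) (subwords xs) ≡ anyTriple t xs
anyᵇ-subwords-onTriples t [] = refl
anyᵇ-subwords-onTriples t (x ∷ xs) rewrite anyᵇ-subwords-∷ (onTriples t) x xs =
  cong₂ _∨_ (trans (anyᵇ-cong (λ { [] → refl ; (_ ∷ []) → refl ; (_ ∷ _ ∷ []) → refl ; (_ ∷ _ ∷ _ ∷ _) → refl })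
                              (subwords xs))
                   (anyᵇ-subwords-onPairs (t x) xs))
            (anyᵇ-subwords-onTriples t xs)

contains-triple : ∀ {v₁ v₂ v₃} t →
                  (∀ a b c → listEqᵇ (standardize (a ∷ b ∷ c ∷ [])) (v₁ ∷ v₂ ∷ v₃ ∷ []) ≡ t a b c) →
                  ∀ w → contains w (v₁ ∷ v₂ ∷ v₃ ∷ []) ≡ anyTriple t w
contains-triple {v₁} {v₂} {v₃} t matches w =
  trans (anyᵇ-cong onLength3 (subwords w)) (anyᵇ-subwords-onTriples t w)
  where
  v = v₁ ∷ v₂ ∷ v₃ ∷ []
  mismatch : ∀ u → length u ≢ 3 → listEqᵇ (standardize u) v ≡ false
  mismatch u ne = listEqᵇ-length (standardize u) v (ne ∘ trans (sym (length-map _ u)))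
  onLength3 : ∀ u → listEqᵇ (standardize u) v ≡ onTriples t u
  onLength3 [] = refl
  onLength3 u@(_ ∷ []) = mismatch u (λ ())
  onLength3 u@(_ ∷ _ ∷ []) = mismatch u (λ ())
  onLength3 (a ∷ b ∷ c ∷ []) = matches a b c
  onLength3 u@(_ ∷ _ ∷ _ ∷ _ ∷ _) = mismatch u (λ ())

anyPair-cong : ∀ {g h} → (∀ y z → g y z ≡ h y z) → ∀ xs → anyPair g xs ≡ anyPair h xs
anyPair-cong eq [] = refl
anyPair-cong eq (y ∷ ys) = cong₂ _∨_ (anyᵇ-cong (eq y) ys) (anyPair-cong eq ys)

anyPair-∨ : ∀ g h xs → anyPair (λ y z → g y z ∨ h y z) xs ≡ anyPair g xs ∨ anyPair h xs
anyPair-∨ g h [] = refl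
anyPair-∨ g h (y ∷ ys) rewrite anyᵇ-∨ (g y) (h y) ys | anyPair-∨ g h ys =
  ∨-interchange (anyᵇ (g y) ys) (anyᵇ (h y) ys) (anyPair g ys) (anyPair h ys)

anyPair-false : ∀ xs → anyPair (λ _ _ → false) xs ≡ false
anyPair-false [] = refl
anyPair-false (x ∷ xs) rewrite anyᵇ-false xs = anyPair-false xs

-- Scanning for an occurrence

≡ᵇ-∧-<ᵇ : ∀ x y z → (x ≡ᵇ y) ∧ (y <ᵇ z) ≡ (x ≡ᵇ y) ∧ (x <ᵇ z)
≡ᵇ-∧-<ᵇ x y z with x ≡ᵇ y in x≡ᵇy
... | true rewrite ≡ᵇ⇒≡′ {x} {y} x≡ᵇy = refl
... | false = refl

∨-regroup : ∀ a b c d e f → a ∨ (b ∨ ((c ∨ d) ∨ (e ∨ f))) ≡ (f ∨ b) ∨ ((a ∨ c) ∨ (d ∨ e))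
∨-regroup = solve 6 (λ a b c d e f → a :+ (b :+ ((c :+ d) :+ (e :+ f))) := (f :+ b) :+ ((a :+ c) :+ (d :+ e))) refl
  where open ∨-∧-Solver

-- Scans a word read after a prefix whose letters form S; B holds the letters that would complete a
-- 112 with the prefix.
completes112 : (ℕ → Bool) → (ℕ → Bool) → List ℕ → Bool
completes112 S B [] = false
completes112 S B (x ∷ xs) = B x ∨ completes112 (λ y → S y ∨ (x ≡ᵇ y)) (λ z → B z ∨ (S x ∧ (x <ᵇ z))) xs

completes112-spec : ∀ S B w → completes112 S B w ≡
  anyTriple pattern112 w ∨ (anyᵇ B w ∨ anyPair (λ y z → S y ∧ (y <ᵇ z)) w)
completes112-spec S B [] = refl
completes112-spec S B (x ∷ xs)
  rewrite completes112-spec (λ y → S y ∨ (x ≡ᵇ y)) (λ z → B z ∨ (S x ∧ (x <ᵇ z))) xs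
        | anyᵇ-∨ B (λ z → S x ∧ (x <ᵇ z)) xs
        | anyᵇ-∧ (S x) (x <ᵇ_) xs
        | anyPair-cong (λ y z → ∧-distribʳ-∨ (y <ᵇ z) (S y) (x ≡ᵇ y)) xs
        | anyPair-∨ (λ y z → S y ∧ (y <ᵇ z)) (λ y z → (x ≡ᵇ y) ∧ (y <ᵇ z)) xs
        | anyPair-cong (≡ᵇ-∧-<ᵇ x) xs
        | anyᵇ-∷ B x xs
  = ∨-regroup
            (B x) (anyTriple pattern112 xs) (anyᵇ B xs) (S x ∧ anyᵇ (x <ᵇ_) xs)
            (anyPair (λ y z → S y ∧ (y <ᵇ z)) xs) (anyPair (pattern112 x) xs)

-- L holds the letters exceeding some letter of the prefix, U those that would complete a 122 with it.
completes122 : (ℕ → Bool) → (ℕ → Bool) → List ℕ → Bool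
completes122 L U [] = false
completes122 L U (x ∷ xs) = U x ∨ completes122 (λ y → L y ∨ (x <ᵇ y)) (λ z → U z ∨ (L x ∧ (x ≡ᵇ z))) xs

completes122-spec : ∀ L U w → completes122 L U w ≡
  anyTriple pattern122 w ∨ (anyᵇ U w ∨ anyPair (λ y z → L y ∧ (y ≡ᵇ z)) w)
completes122-spec L U [] = refl
completes122-spec L U (x ∷ xs)
  rewrite completes122-spec (λ y → L y ∨ (x <ᵇ y)) (λ z → U z ∨ (L x ∧ (x ≡ᵇ z))) xs
        | anyᵇ-∨ U (λ z → L x ∧ (x ≡ᵇ z)) xs
        | anyᵇ-∧ (L x) (x ≡ᵇ_) xs
        | anyPair-cong (λ y z → ∧-distribʳ-∨ (y ≡ᵇ z) (L y) (x <ᵇ y)) xs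
        | anyPair-∨ (λ y z → L y ∧ (y ≡ᵇ z)) (pattern122 x) xs
        | anyᵇ-∷ U x xs
  = ∨-regroup
            (U x) (anyTriple pattern122 xs) (anyᵇ U xs) (L x ∧ anyᵇ (x ≡ᵇ_) xs)
            (anyPair (λ y z → L y ∧ (y ≡ᵇ z)) xs) (anyPair (pattern122 x) xs)

∅ : ℕ → Bool
∅ _ = false

contains-112 : ∀ w → contains w (1 ∷ 1 ∷ 2 ∷ []) ≡ completes112 ∅ ∅ w
contains-112 w rewrite completes112-spec ∅ ∅ w | anyᵇ-false w | anyPair-false w =
  trans (contains-triple pattern112 matches-112 w) (sym (∨-identityʳ _))

contains-122 : ∀ w → contains w (1 ∷ 2 ∷ 2 ∷ []) ≡ completes122 ∅ ∅ w
contains-122 w rewrite completes122-spec ∅ ∅ w | anyᵇ-false w | anyPair-false w =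
  trans (contains-triple pattern122 matches-122 w) (sym (∨-identityʳ _))

completes112-cong : ∀ {S S′ B B′} → (∀ y → S y ≡ S′ y) → (∀ z → B z ≡ B′ z) →
                    ∀ w → completes112 S B w ≡ completes112 S′ B′ w
completes112-cong {S} {S′} {B} {B′} S≗S′ B≗B′ w
  rewrite completes112-spec S B w | completes112-spec S′ B′ w
        | anyᵇ-cong B≗B′ w | anyPair-cong (λ y z → cong (_∧ (y <ᵇ z)) (S≗S′ y)) w = refl

completes122-cong : ∀ {L L′ U U′} → (∀ y → L y ≡ L′ y) → (∀ z → U z ≡ U′ z) →
                    ∀ w → completes122 L U w ≡ completes122 L′ U′ w
completes122-cong {L} {L′} {U} {U′} L≗L′ U≗U′ w
  rewrite completes122-spec L U w | completes122-spec L′ U′ w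
        | anyᵇ-cong U≗U′ w | anyPair-cong (λ y z → cong (_∧ (y ≡ᵇ z)) (L≗L′ y)) w = refl

-- Closed forms

hockey-stick : ∀ c L → Σ< c (λ i → (i + L) C L) ≡ (c + L) C suc L
hockey-stick zero L = sym (k>n⇒nCk≡0 (n<1+n L))
hockey-stick (suc c) L = begin
    Σ< (suc c) (λ i → (i + L) C L)           ≡⟨ Σ<-last c (λ i → (i + L) C L) ⟩
    Σ< c (λ i → (i + L) C L) + (c + L) C L   ≡⟨ cong (_+ (c + L) C L) (hockey-stick c L) ⟩
    (c + L) C suc L + (c + L) C L            ≡⟨ +-comm ((c + L) C suc L) _ ⟩
    (c + L) C L + (c + L) C suc L            ≡⟨ nCk+nC[k+1]≡[n+1]C[k+1] (c + L) L ⟩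
    suc (c + L) C suc L                      ∎
  where open ≡-Reasoning

n+nC2≡[n+1]C2 : ∀ n → n + n C 2 ≡ suc n C 2
n+nC2≡[n+1]C2 n = trans (cong (_+ n C 2) (sym (nC1≡n n))) (nCk+nC[k+1]≡[n+1]C[k+1] n 1)

rhs-suc : ∀ L k → rhs (suc L) k ≡ Σ< (suc L) (λ j → if (suc j C 2) ≡ᵇ k then L C (L ∸ j) else 0)
rhs-suc L k = begin
    rhs (suc L) k
  ≡⟨ cong sum (map-applyUpTo id term (suc (suc L))) ⟩
    term 0 + Σ< (suc L) (term ∘ suc)
  ≡⟨ cong (_+ Σ< (suc L) (term ∘ suc)) term0≡0 ⟩
    Σ< (suc L) (term ∘ suc)
  ∎
  where
  open ≡-Reasoning
  term : ℕ → ℕ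
  term m = if (m C 2) ≡ᵇ k then (suc L ∸ 1) C (suc L ∸ m) else 0
  term0≡0 : term 0 ≡ 0
  term0≡0 = trans (cong (λ c → if (0 C 2) ≡ᵇ k then c else 0) (k>n⇒nCk≡0 (n<1+n L))) (if-0 _)

-- The count for a prefix with maximum suc m and L letters to go.
rbClosed : ℕ → ℕ → ℕ → ℕ
rbClosed m L k = Σ< (suc L) (λ j → if ((suc m + j) C 2) ≡ᵇ k then (m + L) C (L ∸ j) else 0)

rbClosed-suc : ∀ m L k → rbClosed m (suc L) k ≡
               (if (suc m C 2) ≡ᵇ k then (suc m + L) C suc L else 0) + rbClosed (suc m) L k
rbClosed-suc m L k = cong₂ _+_ first (Σ<-cong (suc L) (λ j _ → shifted j))
  where
  first : (if ((suc m + 0) C 2) ≡ᵇ k then (m + suc L) C (suc L ∸ 0) else 0) ≡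
          (if (suc m C 2) ≡ᵇ k then (suc m + L) C suc L else 0)
  first rewrite +-identityʳ m | +-suc m L = refl
  shifted : ∀ j → (if ((suc m + suc j) C 2) ≡ᵇ k then (m + suc L) C (suc L ∸ suc j) else 0) ≡
                  (if ((suc (suc m) + j) C 2) ≡ᵇ k then (suc m + L) C (L ∸ j) else 0)
  shifted j rewrite +-suc m j | +-suc m L = refl

tri : ℕ → ℕ → ℕ
tri m zero = 0
tri m (suc j) = m + tri (suc m) j

tri-closed : ∀ m j → tri m j ≡ m * j + j C 2
tri-closed m zero = sym (trans (+-identityʳ (m * 0)) (*-zeroʳ m))
tri-closed m (suc j) = begin
    m + tri (suc m) j                 ≡⟨ cong (m +_) (tri-closed (suc m) j) ⟩
    m + ((j + m * j) + j C 2)         ≡⟨ solve 4 (λ m j mj c → m :+ ((j :+ mj) :+ c) := (m :+ mj) :+ (j :+ c))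
                                               refl m j (m * j) (j C 2) ⟩
    (m + m * j) + (j + j C 2)         ≡⟨ cong₂ _+_ (sym (*-suc m j)) (n+nC2≡[n+1]C2 j) ⟩
    m * suc j + suc j C 2             ∎
  where
  open ≡-Reasoning
  open +-*-Solver

-- j of the L remaining letters are the new maxima m+1, …, m+j, contributing tri m j to ls.
lsClosed : ℕ → ℕ → ℕ → ℕ → ℕ
lsClosed m L a k = Σ< (suc L) (λ j → if (a + tri m j) ≡ᵇ k then L C j else 0)

lsClosed-suc : ∀ m L a k → lsClosed m (suc L) a k ≡ lsClosed m L a k + lsClosed (suc m) L (a + m) k
lsClosed-suc m L a k = begin
    t₀ + Σ< (suc L) (λ j → if hit j then suc L C suc j else 0)
  ≡⟨ cong (t₀ +_) (trans (Σ<-cong (suc L) (λ j _ → pascal j)) (Σ<-+ (suc L) new old)) ⟩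
    t₀ + (Σ< (suc L) new + Σ< (suc L) old)
  ≡⟨ cong (λ o → t₀ + (Σ< (suc L) new + o)) (trans (Σ<-last L old) (cong (Σ< L old +_) old-L≡0)) ⟩
    t₀ + (Σ< (suc L) new + (Σ< L old + 0))
  ≡⟨ cong (λ o → t₀ + (Σ< (suc L) new + o)) (+-identityʳ (Σ< L old)) ⟩
    t₀ + (Σ< (suc L) new + Σ< L old)
  ≡⟨ trans (cong (t₀ +_) (+-comm (Σ< (suc L) new) _)) (sym (+-assoc t₀ _ _)) ⟩
    lsClosed m L a k + lsClosed (suc m) L (a + m) k
  ∎
  where
  open ≡-Reasoning
  t₀ = if (a + 0) ≡ᵇ k then 1 else 0
  hit : ℕ → Bool
  hit j = (a + tri m (suc j)) ≡ᵇ k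
  new old : ℕ → ℕ
  new j = if ((a + m) + tri (suc m) j) ≡ᵇ k then L C j else 0
  old j = if hit j then L C suc j else 0
  old-L≡0 : old L ≡ 0
  old-L≡0 = trans (cong (λ c → if hit L then c else 0) (k>n⇒nCk≡0 (n<1+n L))) (if-0 (hit L))
  pascal : ∀ j → (if hit j then suc L C suc j else 0) ≡ new j + old j
  pascal j rewrite +-assoc a m (tri (suc m) j) =
    trans (cong (λ c → if hit j then c else 0) (sym (nCk+nC[k+1]≡[n+1]C[k+1] L j))) (if-+ (hit j) _ _)

rhs≡lsClosed : ∀ L k → rhs (suc L) k ≡ lsClosed 1 L 0 k
rhs≡lsClosed L k = trans (rhs-suc L k) (Σ<-cong (suc L) term)
  where
  tri-1 : ∀ j → tri 1 j ≡ suc j C 2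
  tri-1 j = trans (tri-closed 1 j) (trans (cong (_+ j C 2) (*-identityˡ j)) (n+nC2≡[n+1]C2 j))
  term : ∀ j → j < suc L → (if (suc j C 2) ≡ᵇ k then L C (L ∸ j) else 0) ≡ (if tri 1 j ≡ᵇ k then L C j else 0)
  term j j≤L = cong₂ (λ t c → if t ≡ᵇ k then c else 0) (sym (tri-1 j)) (sym (nCk≡nC[n∸k] (≤-pred j≤L)))

-- RB on 112-avoiding RGFs

inRange : ℕ → ℕ → ℕ → Bool
inRange lo hi y = (lo ≤ᵇ y) ∧ (y <ᵇ suc hi)

inRange-true : ∀ {lo hi y} → lo ≤ y → y ≤ hi → inRange lo hi y ≡ true
inRange-true {lo} {hi} {y} lo≤y y≤hi rewrite ≤ᵇ-true lo≤y = <ᵇ-true (s≤s y≤hi)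

inRange-empty : ∀ {lo hi} → hi < lo → ∀ y → ∅ y ≡ inRange lo hi y
inRange-empty {lo} {hi} hi<lo y with lo ≤ᵇ y in lo≤y
... | false = refl
... | true = sym (<ᵇ-false (≤-trans hi<lo (≤ᵇ⇒≤′ lo≤y)))

inRange-∪-member : ∀ {lo hi a} → inRange lo hi a ≡ true → ∀ y → (inRange lo hi y ∨ (a ≡ᵇ y)) ≡ inRange lo hi y
inRange-∪-member {a = a} a∈ y with a ≡ᵇ y in a≡ᵇy
... | false = ∨-identityʳ _
... | true rewrite ≡ᵇ⇒≡′ {a} {y} a≡ᵇy | a∈ = refl

inRange-∪-next : ∀ {lo hi} → lo ≤ suc hi → ∀ y → (inRange lo hi y ∨ (suc hi ≡ᵇ y)) ≡ inRange lo (suc hi) y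
inRange-∪-next {lo} {hi} lo≤ y with suc hi ≡ᵇ y in eq
... | true rewrite sym (≡ᵇ⇒≡′ {suc hi} {y} eq) = trans (∨-zeroʳ _) (sym (inRange-true lo≤ (≤-refl {suc hi})))
... | false rewrite <ᵇ-suc y (suc hi) | ≡ᵇ-sym y (suc hi) | eq = ∨-identityʳ _

∧-shuffle : ∀ l r b f → (l ∧ r) ∧ (b ∧ f) ≡ l ∧ (b ∧ (r ∧ f))
∧-shuffle = solve 4 (λ l r b f → (l :* r) :* (b :* f) := l :* (b :* (r :* f))) refl
  where open ∨-∧-Solver

avoids112From : ℕ → (ℕ → Bool) → (ℕ → Bool) → List ℕ → Bool
avoids112From M S B s = rgfAux M s ∧ not (completes112 S B s)

avoids112From-∷ : ∀ M S B i s → avoids112From M S B (suc i ∷ s) ≡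
  (i <ᵇ suc M) ∧ (not (B (suc i)) ∧
    avoids112From (M ⊔ suc i) (λ y → S y ∨ (suc i ≡ᵇ y)) (λ z → B z ∨ (S (suc i) ∧ (suc i <ᵇ z))) s)
avoids112From-∷ M S B i s =
  trans (cong (((i <ᵇ suc M) ∧ rgfAux (M ⊔ suc i) s) ∧_) (deMorgan₂ (B (suc i)) _))
        (∧-shuffle (i <ᵇ suc M) (rgfAux (M ⊔ suc i) s) (not (B (suc i))) _)

avoids112From-cong : ∀ M {S S′ B B′} → (∀ y → S y ≡ S′ y) → (∀ z → B z ≡ B′ z) →
                     ∀ s → avoids112From M S B s ≡ avoids112From M S′ B′ s
avoids112From-cong M S≗S′ B≗B′ s = cong (λ b → rgfAux M s ∧ not b) (completes112-cong S≗S′ B≗B′ s)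

avoids112-new : ∀ M s → avoids112From M (inRange 1 M) ∅ (suc M ∷ s) ≡ avoids112From (suc M) (inRange 1 (suc M)) ∅ s
avoids112-new M s rewrite avoids112From-∷ M (inRange 1 M) ∅ M s | <ᵇ-true (n<1+n M) | m≤n⇒m⊔n≡n (n≤1+n M) =
  avoids112From-cong (suc M) (inRange-∪-next (s≤s z≤n)) (λ z → cong (_∧ (suc M <ᵇ z)) (<ᵇ-irrefl M)) s

avoids112-repeat : ∀ {M i} s → i < M →
                   avoids112From M (inRange 1 M) ∅ (suc i ∷ s) ≡ avoids112From M (inRange 1 M) (suc i <ᵇ_) s
avoids112-repeat {M} {i} s i<M
  rewrite avoids112From-∷ M (inRange 1 M) ∅ i s | <ᵇ-true (m<n⇒m<1+n i<M) | m≥n⇒m⊔n≡m i<M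
        | inRange-true (s≤s z≤n) i<M =
  avoids112From-cong M (inRange-∪-member {1} {M} {suc i} (inRange-true (s≤s z≤n) i<M)) (λ _ → refl) s

avoids112-descend : ∀ {M c i} s → i < c → c ≤ M →
                    avoids112From M (inRange 1 M) (c <ᵇ_) (suc i ∷ s) ≡ avoids112From M (inRange 1 M) (suc i <ᵇ_) s
avoids112-descend {M} {c} {i} s i<c c≤M
  rewrite avoids112From-∷ M (inRange 1 M) (c <ᵇ_) i s | <ᵇ-true (m<n⇒m<1+n (<-≤-trans i<c c≤M))
        | <ᵇ-false {c} {suc i} i<c | m≥n⇒m⊔n≡m (<-≤-trans i<c c≤M)
        | inRange-true (s≤s z≤n) (<-≤-trans i<c c≤M) =
  avoids112From-cong M (inRange-∪-member {1} {M} {suc i} (inRange-true (s≤s z≤n) (<-≤-trans i<c c≤M))) absorb s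
  where
  absorb : ∀ z → ((c <ᵇ z) ∨ (suc i <ᵇ z)) ≡ (suc i <ᵇ z)
  absorb z with c <ᵇ z in c<z
  ... | false = refl
  ... | true = sym (<ᵇ-true (≤-<-trans i<c (<ᵇ⇒<′ {c} {z} c<z)))

avoids112-too-large : ∀ {M i} S B s → M < i → avoids112From M S B (suc i ∷ s) ≡ false
avoids112-too-large {M} {i} S B s M<i rewrite avoids112From-∷ M S B i s | <ᵇ-false {i} {suc M} M<i = refl

avoids112-ascend : ∀ {M c i} S s → c ≤ i → avoids112From M S (c <ᵇ_) (suc i ∷ s) ≡ false
avoids112-ascend {M} {c} {i} S s c≤i rewrite avoids112From-∷ M S (c <ᵇ_) i s | <ᵇ-true {c} {suc i} (s≤s c≤i) =
  ∧-zeroʳ (i <ᵇ suc M)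

rb-run-++ : ∀ i l t → All (_< i + l) t → rb (run i l ++ t) ≡ l C 2 + rb t
rb-run-++ i zero t _ = refl
rb-run-++ i (suc l) t t<i+l = begin
    nDistinct (filterᵇ (i <ᵇ_) rest) + rb rest   ≡⟨ cong₂ _+_ larger (rb-run-++ (suc i) l t t<B) ⟩
    l + (l C 2 + rb t)                          ≡⟨ sym (+-assoc l _ _) ⟩
    (l + l C 2) + rb t                          ≡⟨ cong (_+ rb t) (n+nC2≡[n+1]C2 l) ⟩
    suc l C 2 + rb t                            ∎
  where
  open ≡-Reasoning
  rest = run (suc i) l ++ t
  B = suc i + l
  t<B : All (_< B) t
  t<B = subst (λ b → All (_< b) t) (+-suc i l) t<i+l
  rest<B : All (_< B) (filterᵇ (i <ᵇ_) rest)
  rest<B = filter⁺ (T? ∘ (i <ᵇ_)) (++⁺ (run-bounded (suc i) l) t<B)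
  inRun : ∀ k → k < B → ind (elem k (filterᵇ (i <ᵇ_) rest)) ≡ ind ((suc i ≤ᵇ k) ∧ (k <ᵇ B))
  inRun k k<B rewrite elem-filterᵇ k (i <ᵇ_) rest | elem-++ k (run (suc i) l) t | elem-run k (suc i) l
                    | <ᵇ-true k<B with i <ᵇ k
  ... | true = refl
  ... | false = cong ind (∧-zeroʳ _)
  larger : nDistinct (filterᵇ (i <ᵇ_) rest) ≡ l
  larger = trans (nDistinct-Σ _ rest<B)
                 (trans (Σ<-cong B inRun) (trans (Σ<-interval B (suc i) B ≤-refl) (m+n∸m≡n (suc i) l)))

data DescendingFrom : ℕ → List ℕ → Set where
  [] : ∀ {c} → DescendingFrom c []
  _∷_ : ∀ {c x xs} → x ≤ c → DescendingFrom x xs → DescendingFrom c (x ∷ xs)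

descending-≤ : ∀ {c xs} → DescendingFrom c xs → All (_≤ c) xs
descending-≤ [] = []
descending-≤ (x≤c ∷ d) = x≤c ∷ All.map (λ y≤x → ≤-trans y≤x x≤c) (descending-≤ d)

rb-descending : ∀ {c xs} → DescendingFrom c xs → rb xs ≡ 0
rb-descending [] = refl
rb-descending {xs = x ∷ xs} (_ ∷ d)
  rewrite filter-none (T? ∘ (x <ᵇ_)) (All.map (λ y≤x x<y → <⇒≱ (<ᵇ⇒< x _ x<y) y≤x) (descending-≤ d)) =
  rb-descending d

avoids112-descending : ∀ {M c} s → c ≤ M → avoids112From M (inRange 1 M) (c <ᵇ_) s ≡ true → DescendingFrom c s
avoids112-descending [] _ _ = []
avoids112-descending {M} {c} (suc i ∷ s) c≤M ok with <-cmp i c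
... | tri< i<c _ _ = i<c ∷ avoids112-descending s (<-≤-trans i<c c≤M) (trans (sym (avoids112-descend s i<c c≤M)) ok)
... | tri≈ _ i≡c _ = contradiction (trans (sym (avoids112-ascend (inRange 1 M) s (≤-reflexive (sym i≡c)))) ok) λ ()
... | tri> _ _ c<i = contradiction (trans (sym (avoids112-ascend (inRange 1 M) s (<⇒≤ c<i))) ok) λ ()

rb-increasing : ∀ M s → avoids112From M (inRange 1 M) ∅ s ≡ true → rb (run 1 M ++ s) ≡ (M ⊔ maximum s) C 2
rb-increasing M [] _ rewrite ⊔-identityʳ M = trans (rb-run-++ 1 M [] []) (+-identityʳ _)
rb-increasing M (suc i ∷ s) ok with <-cmp i M
... | tri> _ _ M<i = contradiction (trans (sym (avoids112-too-large (inRange 1 M) ∅ s M<i)) ok) λ ()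
... | tri≈ _ refl _ = begin
    rb (run 1 i ++ (suc i ∷ s))       ≡⟨ cong rb (run-++-∷ 1 i s) ⟩
    rb (run 1 (suc i) ++ s)           ≡⟨ rb-increasing (suc i) s (trans (sym (avoids112-new i s)) ok) ⟩
    (suc i ⊔ maximum s) C 2           ≡⟨ cong (_C 2) (sym (⊔-⊔-maximum i (suc i) s (m≤n⇒m⊔n≡n (n≤1+n i)))) ⟩
    (i ⊔ (suc i ⊔ maximum s)) C 2     ∎
  where open ≡-Reasoning
... | tri< i<M _ _ = begin
    rb (run 1 M ++ t)        ≡⟨ rb-run-++ 1 M t (All.map s≤s t≤M) ⟩
    M C 2 + rb t             ≡⟨ cong (M C 2 +_) (rb-descending descending) ⟩
    M C 2 + 0                ≡⟨ +-identityʳ _ ⟩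
    M C 2                    ≡⟨ cong (_C 2) (sym (m≥n⇒m⊔n≡m (maximum-least t t≤M))) ⟩
    (M ⊔ maximum t) C 2      ∎
  where
  open ≡-Reasoning
  t = suc i ∷ s
  descending : DescendingFrom M t
  descending = i<M ∷ avoids112-descending s i<M (trans (sym (avoids112-repeat s i<M)) ok)
  t≤M : All (_≤ M) t
  t≤M = descending-≤ descending

-- Continuations of a 112-avoiding prefix with maximum M: B is ∅ while the prefix is 1 2 ⋯ M and
-- (c <ᵇ_) once it has descended to c. The statistic rb is replaced by its value C(max, 2) on
-- 112-avoiders (rb-increasing), which can be tracked letter by letter.
rbWeight : ℕ → ℕ → (ℕ → Bool) → List ℕ → Bool
rbWeight k M B s = avoids112From M (inRange 1 M) B s ∧ (((M ⊔ maximum s) C 2) ≡ᵇ k)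

rbWeight-new : ∀ k M s → rbWeight k M ∅ (suc M ∷ s) ≡ rbWeight k (suc M) ∅ s
rbWeight-new k M s = cong₂ _∧_ (avoids112-new M s)
  (cong (λ m → (m C 2) ≡ᵇ k) (⊔-⊔-maximum M (suc M) s (m≤n⇒m⊔n≡n (n≤1+n M))))

rbWeight-repeat : ∀ k {M i} s → i < M → rbWeight k M ∅ (suc i ∷ s) ≡ rbWeight k M (suc i <ᵇ_) s
rbWeight-repeat k {M} {i} s i<M = cong₂ _∧_ (avoids112-repeat s i<M)
  (cong (λ m → (m C 2) ≡ᵇ k) (⊔-⊔-maximum M (suc i) s (m≥n⇒m⊔n≡m i<M)))

rbWeight-descend : ∀ k {M c i} s → i < c → c ≤ M →
                   rbWeight k M (c <ᵇ_) (suc i ∷ s) ≡ rbWeight k M (suc i <ᵇ_) s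
rbWeight-descend k {M} {c} {i} s i<c c≤M = cong₂ _∧_ (avoids112-descend s i<c c≤M)
  (cong (λ m → (m C 2) ≡ᵇ k) (⊔-⊔-maximum M (suc i) s (m≥n⇒m⊔n≡m (<-≤-trans i<c c≤M))))

rbWeight-too-large : ∀ k {M i} B s → M < i → rbWeight k M B (suc i ∷ s) ≡ false
rbWeight-too-large k {M} B s M<i rewrite avoids112-too-large (inRange 1 M) B s M<i = refl

rbWeight-ascend : ∀ k {M c i} s → c ≤ i → rbWeight k M (c <ᵇ_) (suc i ∷ s) ≡ false
rbWeight-ascend k {M} s c≤i rewrite avoids112-ascend {M} (inRange 1 M) s c≤i = refl

countRbWeight-descending : ∀ K L k {M c} → suc c ≤ M → suc c ≤ K →
  countWords K L (rbWeight k M (suc c <ᵇ_)) ≡ (if (M C 2) ≡ᵇ k then (c + L) C L else 0)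
countRbWeight-descending K zero k {M} {c} _ _
  rewrite countWords-zero K (rbWeight k M (suc c <ᵇ_)) | ⊔-identityʳ M = ind-if _
countRbWeight-descending K (suc L) k {M} {c} c<M c<K = begin
    countWords K (suc L) (rbWeight k M (suc c <ᵇ_))
  ≡⟨ countWords-suc K L _ ⟩
    Σ< K (λ i → countWords K L (rbWeight k M (suc c <ᵇ_) ∘ (suc i ∷_)))
  ≡⟨ Σ<-cong K (λ i _ → next i) ⟩
    Σ< K (λ i → if i <ᵇ suc c then (if (M C 2) ≡ᵇ k then (i + L) C L else 0) else 0)
  ≡⟨ Σ<-prefix K (suc c) (λ i → if (M C 2) ≡ᵇ k then (i + L) C L else 0) c<K ⟩
    Σ< (suc c) (λ i → if (M C 2) ≡ᵇ k then (i + L) C L else 0)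
  ≡⟨ Σ<-if (suc c) ((M C 2) ≡ᵇ k) (λ i → (i + L) C L) ⟩
    (if (M C 2) ≡ᵇ k then Σ< (suc c) (λ i → (i + L) C L) else 0)
  ≡⟨ cong (λ n → if (M C 2) ≡ᵇ k then n else 0)
          (trans (hockey-stick (suc c) L) (cong (_C suc L) (sym (+-suc c L)))) ⟩
    (if (M C 2) ≡ᵇ k then (c + suc L) C suc L else 0)
  ∎
  where
  open ≡-Reasoning
  next : ∀ i → countWords K L (rbWeight k M (suc c <ᵇ_) ∘ (suc i ∷_)) ≡
               (if i <ᵇ suc c then (if (M C 2) ≡ᵇ k then (i + L) C L else 0) else 0)
  next i with i <ᵇ suc c in i<c
  ... | true = trans (countWords-cong K L (λ w → rbWeight-descend k {M} {suc c} {i} w i≤c c<M))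
                     (countRbWeight-descending K L k (≤-trans i≤c c<M) (≤-trans i≤c c<K))
    where i≤c = <ᵇ⇒<′ {i} {suc c} i<c
  ... | false = countWords-none K L (λ w → rbWeight-ascend k {M} {suc c} {i} w (<ᵇ≡false⇒≥ {i} {suc c} i<c))

countRbWeight-step : ∀ K L k M → M < K →
  countWords K (suc L) (rbWeight k M ∅) ≡
  countWords K L (rbWeight k (suc M) ∅) + (if (M C 2) ≡ᵇ k then Σ< M (λ i → (i + L) C L) else 0)
countRbWeight-step K L k M M<K = begin
    countWords K (suc L) (rbWeight k M ∅)
  ≡⟨ countWords-suc K L _ ⟩
    Σ< K (λ i → countWords K L (rbWeight k M ∅ ∘ (suc i ∷_)))
  ≡⟨ Σ<-cong K (λ i _ → next i) ⟩
    Σ< K (λ i → new i + repeat i)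
  ≡⟨ Σ<-+ K new repeat ⟩
    Σ< K new + Σ< K repeat
  ≡⟨ cong₂ _+_ (Σ<-point K M (λ _ → countWords K L (rbWeight k (suc M) ∅)) M<K)
               (trans (Σ<-prefix K M _ (<⇒≤ M<K)) (Σ<-if M ((M C 2) ≡ᵇ k) (λ i → (i + L) C L))) ⟩
    countWords K L (rbWeight k (suc M) ∅) + (if (M C 2) ≡ᵇ k then Σ< M (λ i → (i + L) C L) else 0)
  ∎
  where
  open ≡-Reasoning
  X = countWords K L (rbWeight k (suc M) ∅)
  Y : ℕ → ℕ
  Y i = if (M C 2) ≡ᵇ k then (i + L) C L else 0
  new repeat : ℕ → ℕ
  new i = if i ≡ᵇ M then X else 0
  repeat i = if i <ᵇ M then Y i else 0
  byLetter : ℕ → Bool → Bool → ℕ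
  byLetter i isNew isRepeat = (if isNew then X else 0) + (if isRepeat then Y i else 0)
  next : ∀ i → countWords K L (rbWeight k M ∅ ∘ (suc i ∷_)) ≡ new i + repeat i
  next i with <-cmp i M
  ... | tri< i<M _ _ =
    trans (trans (countWords-cong K L (λ w → rbWeight-repeat k w i<M))
                 (countRbWeight-descending K L k i<M (<-trans i<M M<K)))
          (sym (cong₂ (byLetter i) (≡ᵇ-false (<⇒≢ i<M)) (<ᵇ-true i<M)))
  ... | tri≈ _ refl _ =
    trans (trans (countWords-cong K L (rbWeight-new k i)) (sym (+-identityʳ X)))
          (sym (cong₂ (byLetter i) (≡ᵇ-refl i) (<ᵇ-irrefl i)))
  ... | tri> _ _ M<i =
    trans (countWords-none K L (λ w → rbWeight-too-large k ∅ w M<i))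
          (sym (cong₂ (byLetter i) (≡ᵇ-false (>⇒≢ M<i)) (<ᵇ-false (<⇒≤ M<i))))

countRbWeight : ∀ K L k m → suc m + L ≤ K → countWords K L (rbWeight k (suc m) ∅) ≡ rbClosed m L k
countRbWeight K zero k m _ rewrite countWords-zero K (rbWeight k (suc m) ∅) | +-identityʳ m =
  trans (ind-if _) (sym (+-identityʳ _))
countRbWeight K (suc L) k m bound = begin
    countWords K (suc L) (rbWeight k (suc m) ∅)
  ≡⟨ countRbWeight-step K L k (suc m) (<-≤-trans (m<m+n (suc m) z<s) bound) ⟩
    countWords K L (rbWeight k (suc (suc m)) ∅) + (if (suc m C 2) ≡ᵇ k then Σ< (suc m) (λ i → (i + L) C L) else 0)
  ≡⟨ cong₂ _+_ (countRbWeight K L k (suc m) (subst (_≤ K) (+-suc (suc m) L) bound))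
               (cong (λ n → if (suc m C 2) ≡ᵇ k then n else 0) (hockey-stick (suc m) L)) ⟩
    rbClosed (suc m) L k + (if (suc m C 2) ≡ᵇ k then (suc m + L) C suc L else 0)
  ≡⟨ +-comm (rbClosed (suc m) L k) _ ⟩
    (if (suc m C 2) ≡ᵇ k then (suc m + L) C suc L else 0) + rbClosed (suc m) L k
  ≡⟨ sym (rbClosed-suc m L k) ⟩
    rbClosed m (suc L) k
  ∎
  where open ≡-Reasoning

∧-≡ᵇ-cong : ∀ a b {x y} k → (a ∧ b ≡ true → x ≡ y) → a ∧ (b ∧ (x ≡ᵇ k)) ≡ (a ∧ b) ∧ (y ≡ᵇ k)
∧-≡ᵇ-cong true true k x≡y rewrite x≡y refl = refl
∧-≡ᵇ-cong true false k _ = refl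
∧-≡ᵇ-cong false b k _ = refl

rbWeight-start : ∀ k w → isRGF w ∧ (not (contains w (1 ∷ 1 ∷ 2 ∷ [])) ∧ (rb w ≡ᵇ k)) ≡ rbWeight k 0 ∅ w
rbWeight-start k w =
  trans (cong (λ c → isRGF w ∧ (not c ∧ (rb w ≡ᵇ k)))
              (trans (contains-112 w) (completes112-cong (inRange-empty z<s) (λ _ → refl) w)))
        (∧-≡ᵇ-cong (rgfAux 0 w) _ k (rb-increasing 0 w))

RB-112 : ∀ L k → RB (suc L) (1 ∷ 1 ∷ 2 ∷ []) k ≡ rhs (suc L) k
RB-112 L k = begin
    RB (suc L) (1 ∷ 1 ∷ 2 ∷ []) k
  ≡⟨ genFun-Ravoid rb (suc L) _ k ⟩
    countWords (suc L) (suc L) (λ w → isRGF w ∧ (not (contains w (1 ∷ 1 ∷ 2 ∷ [])) ∧ (rb w ≡ᵇ k)))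
  ≡⟨ countWords-cong (suc L) (suc L) (rbWeight-start k) ⟩
    countWords (suc L) (suc L) (rbWeight k 0 ∅)
  ≡⟨ countRbWeight-step (suc L) L k 0 z<s ⟩
    countWords (suc L) L (rbWeight k 1 ∅) + (if (0 C 2) ≡ᵇ k then 0 else 0)
  ≡⟨ cong₂ _+_ (countRbWeight (suc L) L k 0 ≤-refl) (if-0 _) ⟩
    rbClosed 0 L k + 0
  ≡⟨ trans (+-identityʳ _) (sym (rhs-suc L k)) ⟩
    rhs (suc L) k
  ∎
  where open ≡-Reasoning

-- LS on 122-avoiding RGFs

avoids122From : ℕ → (ℕ → Bool) → (ℕ → Bool) → List ℕ → Bool
avoids122From m L U s = rgfAux m s ∧ not (completes122 L U s)

avoids122From-∷ : ∀ m L U i s → avoids122From m L U (suc i ∷ s) ≡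
  (i <ᵇ suc m) ∧ (not (U (suc i)) ∧
    avoids122From (m ⊔ suc i) (λ y → L y ∨ (suc i <ᵇ y)) (λ z → U z ∨ (L (suc i) ∧ (suc i ≡ᵇ z))) s)
avoids122From-∷ m L U i s =
  trans (cong (((i <ᵇ suc m) ∧ rgfAux (m ⊔ suc i) s) ∧_) (deMorgan₂ (U (suc i)) _))
        (∧-shuffle (i <ᵇ suc m) (rgfAux (m ⊔ suc i) s) (not (U (suc i))) _)

avoids122From-cong : ∀ m {L L′ U U′} → (∀ y → L y ≡ L′ y) → (∀ z → U z ≡ U′ z) →
                     ∀ s → avoids122From m L U s ≡ avoids122From m L′ U′ s
avoids122From-cong m L≗L′ U≗U′ s = cong (λ b → rgfAux m s ∧ not b) (completes122-cong L≗L′ U≗U′ s)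

HasLetters : List ℕ → (ℕ → Bool) → Set
HasLetters p S = ∀ y → elem y p ≡ S y

-- p is the reversed prefix, whose letters are 1, …, m, and a the part of ls it contributes.
lsWeight : ℕ → ℕ → ℕ → List ℕ → List ℕ → Bool
lsWeight k a m p s = avoids122From m (1 <ᵇ_) (inRange 2 m) s ∧ ((a + lsAux p s) ≡ᵇ k)

HasLetters-bounded : ∀ {p m} → HasLetters p (inRange 1 m) → All (_< suc m) p
HasLetters-bounded {p} {m} letters = All.map bounded (elem-self p)
  where
  bounded : ∀ {x} → elem x p ≡ true → x < suc m
  bounded {x} x∈p = <ᵇ⇒<′ (∧-conicalʳ (1 ≤ᵇ x) _ (trans (sym (letters x)) x∈p))

rank-HasLetters : ∀ {p m} → HasLetters p (inRange 1 m) →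
                  ∀ x → rank p x ≡ Σ< (suc m) (λ k → ind (inRange 1 m k ∧ (k <ᵇ x)))
rank-HasLetters {p} {m} letters x =
  trans (rank-Σ p x (HasLetters-bounded letters))
        (Σ<-cong (suc m) (λ k _ → cong (λ b → ind (b ∧ (k <ᵇ x))) (letters k)))

rank-1 : ∀ {p m} → HasLetters p (inRange 1 m) → rank p 1 ≡ 0
rank-1 {p} {m} letters = trans (rank-HasLetters {p} letters 1) (Σ<-zero (suc m) (λ k _ → below k))
  where
  below : ∀ k → ind (inRange 1 m k ∧ (k <ᵇ 1)) ≡ 0
  below zero = refl
  below (suc k) = cong ind (∧-zeroʳ _)

rank-suc-max : ∀ {p m} → HasLetters p (inRange 1 m) → rank p (suc m) ≡ m
rank-suc-max {p} {m} letters =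
  trans (rank-HasLetters {p} letters (suc m))
        (trans (Σ<-cong (suc m) (λ k _ → cong ind (trans (∧-assoc (1 ≤ᵇ k) (k <ᵇ suc m) (k <ᵇ suc m))
                                                          (cong ((1 ≤ᵇ k) ∧_) (∧-idem (k <ᵇ suc m))))))
               (Σ<-interval (suc m) 1 (suc m) ≤-refl))

HasLetters-one : ∀ {p m} → 1 ≤ m → HasLetters p (inRange 1 m) → HasLetters (1 ∷ p) (inRange 1 m)
HasLetters-one {p} {m} 1≤m letters y
  rewrite elem-∷ y 1 p | letters y | ≡ᵇ-sym y 1 | ∨-comm (1 ≡ᵇ y) (inRange 1 m y) =
  inRange-∪-member {1} {m} {1} (inRange-true ≤-refl 1≤m) y

HasLetters-new : ∀ {p m} → HasLetters p (inRange 1 m) → HasLetters (suc m ∷ p) (inRange 1 (suc m))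
HasLetters-new {p} {m} letters y
  rewrite elem-∷ y (suc m) p | letters y | ≡ᵇ-sym y (suc m) | ∨-comm (suc m ≡ᵇ y) (inRange 1 m y) =
  inRange-∪-next (s≤s z≤n) y

lsWeight-one : ∀ k a {m p} s → 1 ≤ m → HasLetters p (inRange 1 m) →
               lsWeight k a m p (1 ∷ s) ≡ lsWeight k a m (1 ∷ p) s
lsWeight-one k a {m} {p} s 1≤m letters
  rewrite avoids122From-∷ m (1 <ᵇ_) (inRange 2 m) 0 s | m≥n⇒m⊔n≡m 1≤m | rank-1 {p} letters =
  cong (_∧ ((a + lsAux (1 ∷ p) s) ≡ᵇ k))
       (avoids122From-cong m (λ y → ∨-idem (1 <ᵇ y)) (λ z → ∨-identityʳ _) s)

lsWeight-new : ∀ k a {m p} s → 1 ≤ m → HasLetters p (inRange 1 m) →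
               lsWeight k a m p (suc m ∷ s) ≡ lsWeight k (a + m) (suc m) (suc m ∷ p) s
lsWeight-new k a {m} {p} s 1≤m letters
  rewrite avoids122From-∷ m (1 <ᵇ_) (inRange 2 m) m s | <ᵇ-true (n<1+n m) | <ᵇ-irrefl m
        | ∧-zeroʳ (2 ≤ᵇ suc m) | m≤n⇒m⊔n≡n (n≤1+n m) | rank-suc-max {p} letters
        | sym (+-assoc a m (lsAux (suc m ∷ p) s)) =
  cong (_∧ ((a + m + lsAux (suc m ∷ p) s) ≡ᵇ k)) (avoids122From-cong (suc m) exceeds1 twoTo-next s)
  where
  twoTo-next : ∀ z → (inRange 2 m z ∨ ((1 <ᵇ suc m) ∧ (suc m ≡ᵇ z))) ≡ inRange 2 (suc m) z
  twoTo-next z rewrite <ᵇ-true {1} {suc m} (s≤s 1≤m) = inRange-∪-next (s≤s 1≤m) z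
  exceeds1 : ∀ y → ((1 <ᵇ y) ∨ (suc m <ᵇ y)) ≡ (1 <ᵇ y)
  exceeds1 y with 1 <ᵇ y in 1<y
  ... | true = refl
  ... | false = <ᵇ-false (≤-trans (<ᵇ≡false⇒≥ {1} {y} 1<y) (s≤s z≤n))

lsWeight-repeat : ∀ k a {m p i} s → 1 ≤ i → i < m → lsWeight k a m p (suc i ∷ s) ≡ false
lsWeight-repeat k a {m} {p} {i} s 1≤i i<m
  rewrite avoids122From-∷ m (1 <ᵇ_) (inRange 2 m) i s | inRange-true {2} {m} {suc i} (s≤s 1≤i) i<m =
  cong (_∧ ((a + lsAux p (suc i ∷ s)) ≡ᵇ k)) (∧-zeroʳ (i <ᵇ suc m))

lsWeight-too-large : ∀ k a {m p i} s → m < i → lsWeight k a m p (suc i ∷ s) ≡ false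
lsWeight-too-large k a {m} {p} {i} s m<i
  rewrite avoids122From-∷ m (1 <ᵇ_) (inRange 2 m) i s | <ᵇ-false {i} {suc m} m<i = refl

countLsWeight : ∀ K L k a m p → 1 ≤ m → m + L ≤ K → HasLetters p (inRange 1 m) →
                countWords K L (lsWeight k a m p) ≡ lsClosed m L a k
countLsWeight K zero k a m p _ _ _ =
  trans (countWords-zero K (lsWeight k a m p)) (trans (ind-if _) (sym (+-identityʳ _)))
countLsWeight K (suc L) k a m p 1≤m bound letters = begin
    countWords K (suc L) (lsWeight k a m p)
  ≡⟨ countWords-suc K L _ ⟩
    Σ< K (λ i → countWords K L (lsWeight k a m p ∘ (suc i ∷_)))
  ≡⟨ Σ<-cong K (λ i _ → next i) ⟩
    Σ< K (λ i → one i + new i)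
  ≡⟨ Σ<-+ K one new ⟩
    Σ< K one + Σ< K new
  ≡⟨ cong₂ _+_ (Σ<-point K 0 (λ _ → X) (<-trans 1≤m m<K)) (Σ<-point K m (λ _ → Y) m<K) ⟩
    X + Y
  ≡⟨ sym (lsClosed-suc m L a k) ⟩
    lsClosed m (suc L) a k
  ∎
  where
  open ≡-Reasoning
  m<K : m < K
  m<K = <-≤-trans (m<m+n m z<s) bound
  X = lsClosed m L a k
  Y = lsClosed (suc m) L (a + m) k
  one new : ℕ → ℕ
  one i = if i ≡ᵇ 0 then X else 0
  new i = if i ≡ᵇ m then Y else 0
  byLetter : Bool → Bool → ℕ
  byLetter isOne isNew = (if isOne then X else 0) + (if isNew then Y else 0)
  next : ∀ i → countWords K L (lsWeight k a m p ∘ (suc i ∷_)) ≡ one i + new i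
  next zero =
    trans (trans (countWords-cong K L (λ w → lsWeight-one k a w 1≤m letters))
                 (trans (countLsWeight K L k a m (1 ∷ p) 1≤m (≤-trans (+-monoʳ-≤ m (n≤1+n L)) bound)
                                       (HasLetters-one {p} 1≤m letters))
                        (sym (+-identityʳ X))))
          (sym (cong (byLetter true) (≡ᵇ-false (<⇒≢ 1≤m))))
  next (suc i) with <-cmp (suc i) m
  ... | tri< i<m _ _ =
    trans (countWords-none K L (λ w → lsWeight-repeat k a w (s≤s z≤n) i<m))
          (sym (cong (byLetter false) (≡ᵇ-false (<⇒≢ i<m))))
  ... | tri≈ _ refl _ =
    trans (countWords-cong K L (λ w → lsWeight-new k a w 1≤m letters))
          (trans (countLsWeight K L k (a + suc i) (suc (suc i)) _ (s≤s z≤n) (subst (_≤ K) (+-suc (suc i) L) bound)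
                          (HasLetters-new {p} letters))
                 (sym (cong (byLetter false) (≡ᵇ-refl i))))
  ... | tri> _ _ m<i =
    trans (countWords-none K L (λ w → lsWeight-too-large k a w m<i))
          (sym (cong (byLetter false) (≡ᵇ-false (>⇒≢ m<i))))

lsWeight-start : ∀ k s → isRGF (1 ∷ s) ∧ (not (completes122 ∅ ∅ (1 ∷ s)) ∧ (ls (1 ∷ s) ≡ᵇ k)) ≡
                         lsWeight k 0 1 (1 ∷ []) s
lsWeight-start k s = trans (sym (∧-assoc (rgfAux 1 s) _ _))
                     (cong (λ u → (rgfAux 1 s ∧ not u) ∧ (lsAux (1 ∷ []) s ≡ᵇ k))
                           (completes122-cong (λ _ → refl) (inRange-empty (s≤s (s≤s z≤n))) s))

LS-122 : ∀ L k → LS (suc L) (1 ∷ 2 ∷ 2 ∷ []) k ≡ rhs (suc L) k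
LS-122 L k = begin
    LS (suc L) (1 ∷ 2 ∷ 2 ∷ []) k
  ≡⟨ genFun-Ravoid ls (suc L) _ k ⟩
    countWords (suc L) (suc L) (λ w → isRGF w ∧ (not (contains w (1 ∷ 2 ∷ 2 ∷ [])) ∧ (ls w ≡ᵇ k)))
  ≡⟨ countWords-cong (suc L) (suc L) (λ w → cong (λ c → isRGF w ∧ (not c ∧ (ls w ≡ᵇ k))) (contains-122 w)) ⟩
    countWords (suc L) (suc L) start
  ≡⟨ countWords-suc (suc L) L start ⟩
    Σ< (suc L) (λ i → countWords (suc L) L (start ∘ (suc i ∷_)))
  ≡⟨ Σ<-cong (suc L) (λ i _ → first i) ⟩
    Σ< (suc L) (λ i → if i ≡ᵇ 0 then lsClosed 1 L 0 k else 0)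
  ≡⟨ Σ<-point (suc L) 0 (λ _ → lsClosed 1 L 0 k) z<s ⟩
    lsClosed 1 L 0 k
  ≡⟨ sym (rhs≡lsClosed L k) ⟩
    rhs (suc L) k
  ∎
  where
  open ≡-Reasoning
  start : List ℕ → Bool
  start w = isRGF w ∧ (not (completes122 ∅ ∅ w) ∧ (ls w ≡ᵇ k))
  first : ∀ i → countWords (suc L) L (start ∘ (suc i ∷_)) ≡ (if i ≡ᵇ 0 then lsClosed 1 L 0 k else 0)
  first zero = trans (countWords-cong (suc L) L (lsWeight-start k))
                     (countLsWeight (suc L) L k 0 1 (1 ∷ []) ≤-refl ≤-refl
                                    (λ { zero → refl ; (suc zero) → refl ; (suc (suc y)) → refl }))
  first (suc i) = countWords-none (suc L) L (λ _ → refl)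

theorem2p11 : (n : ℕ) → 1 ≤ n →
    (RB n (1 ∷ 1 ∷ 2 ∷ []) ≈ₚ rhs n) × (LS n (1 ∷ 2 ∷ 2 ∷ []) ≈ₚ rhs n)
theorem2p11 (suc L) _ = RB-112 L , LS-122 L
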